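{- Let $\mathcal{A}$ be a recursive algorithm enumerating a finite set $S$, and assume that $\mathcal{A}$ satisfies the Pyramid condition with respect to a potential function $\Phi$, time $T^\star>0$ and constant $\mu>0$. Then for every iteration $X$ of $\mathcal{A}$, the total number of instructions executed in the subtree of $X$ (i.e., by $X$ and all its descendant iterations) is at most $T^\star\bigl(\mu |X| - \Phi(X)\bigr)$.
   Context: Setting (recursive enumeration algorithms): A recursive algorithm $\mathcal{A}$ enumerates ("visits") every element of a finite set $S$ exactly once. Its recursive calls form a recursion tree; an iteration is one execution of the recursive function, excluding the computation done inside the calls it makes recursively, and iterations are identified with nodes of the recursion tree. Each iteration is labeled by the set $X\subseteq S$ of elements visited by that iteration or any of its descendants (the root iteration is labeled $S$). In iteration $X$ a partition $X = X_1 \,\dot\cup\, \cdots \,\dot\cup\, X_m \,\dot\cup\, X'$ with $X_1,\dots,X_m\neq\emptyset$ is formed, where $X'$ (possibly empty) is the set of elements visited directly by $X$, and the function is called recursively on $X_1,\dots,X_m$; these iterations are the children of $X$, and their set is denoted $C(X)$. The subtree of $X$ consists of $X$ and all its descendants. $T(X)$ denotes the number of instructions executed by iteration $X$ itself (not counting its descendants). A potential function $\Phi$ assigns a number $\Phi(X)>0$ to every iteration $X$. Pyramid condition: $\mathcal{A}$ satisfies the Pyramid condition with respect to $\Phi$ and time $T^\star$ if there is a constant $\mu>0$ such that for every iteration $X$, $$\sum_{Y\in C(X)} \Phi(Y) + \mu |X'| - \Phi(X) \ \ge\ \frac{T(X)}{T^\star}.$$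
   Formalization: The values of the potential function $\Phi$, the time $T^\star$ and the constant $\mu$ are rational numbers. -}

module Defs where

open import Data.Nat using (ℕ)
open import Data.Integer using (+_)
open import Data.Rational using (ℚ; 0ℚ; _+_; _-_; _*_; _÷_; _≤_; _<_; _/_; >-nonZero)
open import Data.List using (List; []; _∷_; _++_; length; map; foldr)
open import Data.List.Membership.Propositional using (_∈_)
open import Data.List.Relation.Unary.All using (All)
open import Data.List.Relation.Unary.Unique.Propositional using (Unique)
open import Data.List.Relation.Binary.Permutation.Propositional using (_↭_)
open import Data.Product using (_×_)
open import Relation.Binary.PropositionalEquality using (_≢_)

-- A node of the recursion tree (= an iteration) of a recursive enumeration
-- algorithm over elements of type A.
--   direct   : the elements X' visited directly by this iteration
--   cost     : T(X), number of instructions executed by the iteration itself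
--   pot      : Φ(X), the value of the potential function at this iteration
--   children : the iterations called recursively (C(X))
data Iter (A : Set) : Set where
  iter : (direct : List A) (cost : ℕ) (pot : ℚ) (children : List (Iter A)) → Iter A

module _ {A : Set} where

  direct : Iter A → List A
  direct (iter d _ _ _) = d

  cost : Iter A → ℕ
  cost (iter _ c _ _) = c

  pot : Iter A → ℚ
  pot (iter _ _ p _) = p

  children : Iter A → List (Iter A)
  children (iter _ _ _ cs) = cs

  -- the label X of an iteration: all elements visited by it or its descendants
  mutual
    visited : Iter A → List A
    visited (iter d _ _ cs) = d ++ visitedAll cs

    visitedAll : List (Iter A) → List A
    visitedAll []       = []
    visitedAll (c ∷ cs) = visited c ++ visitedAll cs

  mutual
    subtreeCost : Iter A → ℕ
    subtreeCost (iter _ c _ cs) = c Data.Nat.+ subtreeCostAll cs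

    subtreeCostAll : List (Iter A) → ℕ
    subtreeCostAll []       = 0
    subtreeCostAll (c ∷ cs) = subtreeCost c Data.Nat.+ subtreeCostAll cs

  data _≼_ : Iter A → Iter A → Set where
    here  : ∀ {X} → X ≼ X
    below : ∀ {X Y R} → X ≼ Y → Y ∈ children R → X ≼ R

ℕtoℚ : ℕ → ℚ
ℕtoℚ n = + n / 1

sumℚ : List ℚ → ℚ
sumℚ = foldr _+_ 0ℚ

card : {A : Set} → Iter A → ℚ
card X = ℕtoℚ (length (visited X))

-- The recursion tree with root R is the recursion tree of an algorithm
-- enumerating the finite set S (S given as a duplicate-free list):
-- every element of S is visited exactly once, and every recursive call is
-- on a nonempty set X_i.
IsEnumerationTree : {A : Set} → List A → Iter A → Set
IsEnumerationTree S R =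
  Unique S × (Unique (visited R) × (visited R ↭ S)) ×
  (∀ X → X ≼ R → All (λ Y → visited Y ≢ []) (children X))

PositivePotential : {A : Set} → Iter A → Set
PositivePotential R = ∀ X → X ≼ R → 0ℚ < pot X

Pyramid : {A : Set} → (R : Iter A) → (Tstar : ℚ) → 0ℚ < Tstar → (μ : ℚ) → Set
Pyramid R Tstar Tpos μ =
  ∀ X → X ≼ R →
    ((ℕtoℚ (cost X)) ÷ Tstar) {{>-nonZero Tpos}}
      ≤ (sumℚ (map pot (children X)) + μ * ℕtoℚ (length (direct X))) - pot X

{-# OPTIONS --safe #-}
module Submission where

open import Defs
open import Data.List using (List; []; _∷_; _++_; length; map)
open import Data.List.Properties using (length-++)
open import Data.List.Membership.Propositional using (_∈_)
open import Data.List.Relation.Unary.Any using (here; there)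
open import Data.Nat as ℕ using (ℕ)
open import Data.Integer as ℤ using (+_)
import Data.Integer.Properties as ℤ
open import Data.Nat.Coprimality using (1-coprimeTo) renaming (sym to coprime-sym)
open import Data.Rational
  using (ℚ; 0ℚ; 1ℚ; mkℚ; _/_; _+_; _-_; _*_; _÷_; 1/_; _≤_; _<_; NonZero; >-nonZero; positive)
open import Data.Rational.Properties
  using (↥p/↧p≡p; /-cong; *-comm; *-assoc; *-inverseʳ; *-identityˡ; *-zeroʳ;
         pos⇒nonNeg; *-monoˡ-≤-nonNeg; +-mono-≤; ≤-reflexive; module ≤-Reasoning)
open import Data.Rational.Solver using (module +-*-Solver)
open import Relation.Binary.PropositionalEquality using (_≡_; refl; sym; trans; cong; cong₂; subst; module ≡-Reasoning)

-- Summing the Pyramid inequality over a subtree telescopes: each Φ(Y) of a child is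
-- paid for by the bound on Y's own subtree, and the μ|X'| terms add up to μ|X|.
-- Only the local inequalities are used.

ℕtoℚ-homo-+ : ∀ m n → ℕtoℚ (m ℕ.+ n) ≡ ℕtoℚ m + ℕtoℚ n
ℕtoℚ-homo-+ m n = begin
  + (m ℕ.+ n) / 1                           ≡⟨ /-cong numerators refl ⟩
  (+ m ℤ.* + 1 ℤ.+ + n ℤ.* + 1) / (1 ℕ.* 1) ≡⟨⟩
  integral m + integral n                   ≡⟨ sym (cong₂ _+_ (ℕtoℚ≡integral m) (ℕtoℚ≡integral n)) ⟩
  ℕtoℚ m + ℕtoℚ n                           ∎
  where
  open ≡-Reasoning
  integral : ℕ → ℚ
  integral k = mkℚ (+ k) 0 (coprime-sym (1-coprimeTo k))
  ℕtoℚ≡integral : ∀ k → ℕtoℚ k ≡ integral k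
  ℕtoℚ≡integral k = ↥p/↧p≡p (integral k)
  numerators : + (m ℕ.+ n) ≡ + m ℤ.* + 1 ℤ.+ + n ℤ.* + 1
  numerators = sym (cong₂ ℤ._+_ (ℤ.*-identityʳ (+ m)) (ℤ.*-identityʳ (+ n)))

ℕtoℚ-length-++ : ∀ {A : Set} (xs ys : List A) →
  ℕtoℚ (length (xs ++ ys)) ≡ ℕtoℚ (length xs) + ℕtoℚ (length ys)
ℕtoℚ-length-++ xs ys = trans (cong ℕtoℚ (length-++ xs)) (ℕtoℚ-homo-+ (length xs) (length ys))

q*[p÷q]≡p : ∀ p q .{{_ : NonZero q}} → q * (p ÷ q) ≡ p
q*[p÷q]≡p p q = begin
  q * (p * 1/ q)   ≡⟨ cong (q *_) (*-comm p (1/ q)) ⟩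
  q * (1/ q * p)   ≡⟨ *-assoc q (1/ q) p ⟨
  (q * 1/ q) * p   ≡⟨ cong (_* p) (*-inverseʳ q) ⟩
  1ℚ * p           ≡⟨ *-identityˡ p ⟩
  p                ∎
  where open ≡-Reasoning

p÷q≤r⇒p≤q*r : ∀ {p r} q (0<q : 0ℚ < q) → (p ÷ q) {{>-nonZero 0<q}} ≤ r → p ≤ q * r
p÷q≤r⇒p≤q*r {p} {r} q 0<q p÷q≤r =
  subst (_≤ q * r) (q*[p÷q]≡p p q) (*-monoˡ-≤-nonNeg q p÷q≤r)
  where
  instance
    _ : NonZero q
    _ = >-nonZero 0<q
    _ = pos⇒nonNeg q {{positive 0<q}}

module _ {A : Set} where

  ≼-trans : {X Y Z : Iter A} → X ≼ Y → Y ≼ Z → X ≼ Z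
  ≼-trans X≼Y here          = X≼Y
  ≼-trans X≼Y (below Y≼W W) = below (≼-trans X≼Y Y≼W) W

  Everywhere : (Iter A → Set) → Iter A → Set
  Everywhere P R = ∀ X → X ≼ R → P X

  everywhere-child : ∀ {P X Y} → Everywhere P X → Y ∈ children X → Everywhere P Y
  everywhere-child P[X] Y∈X Z Z≼Y = P[X] Z (below Z≼Y Y∈X)

  everywhere-≼ : ∀ {P X R} → Everywhere P R → X ≼ R → Everywhere P X
  everywhere-≼ P[R] X≼R Z Z≼X = P[R] Z (≼-trans Z≼X X≼R)

telescope-node : ∀ T μ φ a b p → T * ((φ + μ * a) - p) + T * (μ * b - φ) ≡ T * (μ * (a + b) - p)
telescope-node = solve 6 (λ T μ φ a b p →
  T :* ((φ :+ μ :* a) :- p) :+ T :* (μ :* b :- φ) := T :* (μ :* (a :+ b) :- p)) refl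
  where open +-*-Solver

telescope-siblings : ∀ T μ a b p q → T * (μ * a - p) + T * (μ * b - q) ≡ T * (μ * (a + b) - (p + q))
telescope-siblings = solve 6 (λ T μ a b p q →
  T :* (μ :* a :- p) :+ T :* (μ :* b :- q) := T :* (μ :* (a :+ b) :- (p :+ q))) refl
  where open +-*-Solver

module _ {A : Set} (T μ : ℚ) where

  PyramidAt : Iter A → Set
  PyramidAt X = ℕtoℚ (cost X) ≤ T * ((sumℚ (map pot (children X)) + μ * ℕtoℚ (length (direct X))) - pot X)

  mutual
    subtreeCost-≤ : ∀ X → Everywhere PyramidAt X → ℕtoℚ (subtreeCost X) ≤ T * (μ * card X - pot X)
    subtreeCost-≤ X@(iter d c p cs) pyr = begin
      ℕtoℚ (c ℕ.+ subtreeCostAll cs)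
        ≡⟨ ℕtoℚ-homo-+ c _ ⟩
      ℕtoℚ c + ℕtoℚ (subtreeCostAll cs)
        ≤⟨ +-mono-≤ (pyr X here) (subtreeCostAll-≤ cs (everywhere-child pyr)) ⟩
      T * ((Φ[cs] + μ * ℕtoℚ (length d)) - p) + T * (μ * ℕtoℚ (length (visitedAll cs)) - Φ[cs])
        ≡⟨ telescope-node T μ Φ[cs] _ _ p ⟩
      T * (μ * (ℕtoℚ (length d) + ℕtoℚ (length (visitedAll cs))) - p)
        ≡⟨ cong (λ n → T * (μ * n - p)) (ℕtoℚ-length-++ d (visitedAll cs)) ⟨
      T * (μ * card X - p) ∎
      where
      open ≤-Reasoning
      Φ[cs] : ℚ
      Φ[cs] = sumℚ (map pot cs)

    subtreeCostAll-≤ : ∀ Xs → (∀ {Y} → Y ∈ Xs → Everywhere PyramidAt Y) →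
      ℕtoℚ (subtreeCostAll Xs) ≤ T * (μ * ℕtoℚ (length (visitedAll Xs)) - sumℚ (map pot Xs))
    subtreeCostAll-≤ [] _ = ≤-reflexive (begin-equality
      0ℚ                  ≡⟨ *-zeroʳ T ⟨
      T * 0ℚ              ≡⟨ cong (λ x → T * (x - 0ℚ)) (*-zeroʳ μ) ⟨
      T * (μ * 0ℚ - 0ℚ)   ∎)
      where open ≤-Reasoning
    subtreeCostAll-≤ (Y ∷ Xs) pyr = begin
      ℕtoℚ (subtreeCost Y ℕ.+ subtreeCostAll Xs)
        ≡⟨ ℕtoℚ-homo-+ (subtreeCost Y) _ ⟩
      ℕtoℚ (subtreeCost Y) + ℕtoℚ (subtreeCostAll Xs)
        ≤⟨ +-mono-≤ (subtreeCost-≤ Y (pyr (here refl))) (subtreeCostAll-≤ Xs (λ Y∈Xs → pyr (there Y∈Xs))) ⟩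
      T * (μ * card Y - pot Y) + T * (μ * ℕtoℚ (length (visitedAll Xs)) - Φ[Xs])
        ≡⟨ telescope-siblings T μ _ _ (pot Y) Φ[Xs] ⟩
      T * (μ * (card Y + ℕtoℚ (length (visitedAll Xs))) - (pot Y + Φ[Xs]))
        ≡⟨ cong (λ n → T * (μ * n - (pot Y + Φ[Xs]))) (ℕtoℚ-length-++ (visited Y) (visitedAll Xs)) ⟨
      T * (μ * ℕtoℚ (length (visited Y ++ visitedAll Xs)) - (pot Y + Φ[Xs])) ∎
      where
      open ≤-Reasoning
      Φ[Xs] : ℚ
      Φ[Xs] = sumℚ (map pot Xs)

lemma2p3 : {A : Set} (S : List A) (R : Iter A) (Tstar μ : ℚ) (Tpos : 0ℚ < Tstar) →
    0ℚ < μ → IsEnumerationTree S R → PositivePotential R → Pyramid R Tstar Tpos μ →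
    ∀ X → X ≼ R → ℕtoℚ (subtreeCost X) ≤ Tstar * (μ * card X - pot X)
lemma2p3 S R Tstar μ Tpos _ _ _ pyramid X X≼R =
  subtreeCost-≤ Tstar μ X (everywhere-≼ pyramidAt X≼R)
  where
  pyramidAt : Everywhere (PyramidAt Tstar μ) R
  pyramidAt Z Z≼R = p÷q≤r⇒p≤q*r Tstar Tpos (pyramid Z Z≼R)
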